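{- Let $(!,\delta,\varepsilon,\mathsf m,\mathsf m_K)$ be a symmetric monoidal comonad on a symmetric monoidal category $(\mathbb X,\otimes,K)$. Then the following are in bijective correspondence: (1) cocommutative bimonoids in $(\mathbb X^!,\otimes^{\mathsf m},(K,\mathsf m_K))$; (2) cocommutative bimonoids $(A,\nabla,\mathsf u,\Delta,\mathsf e)$ in $(\mathbb X,\otimes,K)$ equipped with a natural transformation $\lambda_X:A\otimes!X\to!(A\otimes X)$ such that $\lambda$ is a symmetric monoidal mixed distributive law of $(A\otimes-,\mu^\nabla,\eta^{\mathsf u},\mathsf n^\Delta,\mathsf n^{\mathsf e}_K)$ over $(!,\delta,\varepsilon,\mathsf m,\mathsf m_K)$ and $!(\alpha_{A,X,Y})\circ\lambda_{X\otimes Y}\circ(1_A\otimes\mathsf m_{X,Y})=\mathsf m_{A\otimes X,Y}\circ(\lambda_X\otimes1_{!Y})\circ\alpha_{A,!X,!Y}$ for all objects $X,Y$.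
   Context: Composition is written $g\circ f$; $(\mathbb X,\otimes,K)$ is symmetric monoidal with associator $\alpha_{A,B,C}:A\otimes(B\otimes C)\to(A\otimes B)\otimes C$, unitors $\ell,\rho$, symmetry $\sigma$, and interchange iso $\tau_{A,B,C,D}:(A\otimes B)\otimes(C\otimes D)\to(A\otimes C)\otimes(B\otimes D)$. Symmetric monoidal comonad $(!,\delta,\varepsilon,\mathsf m,\mathsf m_K)$: comonad with natural $\mathsf m_{A,B}:!A\otimes!B\to!(A\otimes B)$, $\mathsf m_K:K\to!K$ making $!$ symmetric lax monoidal, with $\delta,\varepsilon$ monoidal transformations. Its Eilenberg–Moore category of coalgebras $\mathbb X^!$ is symmetric monoidal with $(A,\omega)\otimes^{\mathsf m}(B,\omega')=(A\otimes B,\mathsf m_{A,B}\circ(\omega\otimes\omega'))$, unit $(K,\mathsf m_K)$; a cocommutative bimonoid in it is a coalgebra $(A,\omega)$ with a cocommutative bimonoid structure $(A,\nabla,\mathsf u,\Delta,\mathsf e)$ in $\mathbb X$ all of whose structure maps are coalgebra morphisms. For a cocommutative bimonoid $(A,\nabla,\mathsf u,\Delta,\mathsf e)$ in $\mathbb X$, $(A\otimes-,\mu^\nabla,\eta^{\mathsf u},\mathsf n^\Delta,\mathsf n^{\mathsf e}_K)$ is the symmetric comonoidal monad with $\mu^\nabla_X=(\nabla\otimes1_X)\circ\alpha_{A,A,X}$, $\eta^{\mathsf u}_X=(\mathsf u\otimes1_X)\circ\ell_X^{ -1}$, $\mathsf n^\Delta_{X,Y}=\tau_{A,A,X,Y}\circ(\Delta\otimes1_{X\otimes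 Y})$, $\mathsf n^{\mathsf e}_K=\mathsf e\circ\rho_A$. For a monad $(\mathsf T,\mu,\eta)$ with comonoidal structure $\mathsf n_{A,B}:\mathsf T(A\otimes B)\to\mathsf TA\otimes\mathsf TB$, $\mathsf n_K:\mathsf TK\to K$, a symmetric monoidal mixed distributive law over $(!,\delta,\varepsilon,\mathsf m,\mathsf m_K)$ is a natural $\lambda_A:\mathsf T!A\to!\mathsf TA$ with $\lambda_A\circ\mu_{!A}=!(\mu_A)\circ\lambda_{\mathsf TA}\circ\mathsf T(\lambda_A)$, $\lambda_A\circ\eta_{!A}=!(\eta_A)$, $\delta_{\mathsf TA}\circ\lambda_A=!(\lambda_A)\circ\lambda_{!A}\circ\mathsf T(\delta_A)$, $\varepsilon_{\mathsf TA}\circ\lambda_A=\mathsf T(\varepsilon_A)$, $!(\mathsf n_{A,B})\circ\lambda_{A\otimes B}\circ\mathsf T(\mathsf m_{A,B})=\mathsf m_{\mathsf TA,\mathsf TB}\circ(\lambda_A\otimes\lambda_B)\circ\mathsf n_{!A,!B}$, $!(\mathsf n_K)\circ\lambda_K\circ\mathsf T(\mathsf m_K)=\mathsf m_K\circ\mathsf n_K$. -}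

module Defs where

open import Level using (Level; _⊔_; suc)
open import Relation.Binary.Structures using (IsEquivalence)

record Category (o ℓ e : Level) : Set (suc (o ⊔ ℓ ⊔ e)) where
  infixr 9 _∘_
  infix  4 _≈_
  field
    Obj : Set o
    _⇒_ : Obj → Obj → Set ℓ
    _≈_ : ∀ {A B} → A ⇒ B → A ⇒ B → Set e
    id  : ∀ {A} → A ⇒ A
    _∘_ : ∀ {A B C} → B ⇒ C → A ⇒ B → A ⇒ C
    ≈-equiv    : ∀ {A B} → IsEquivalence (_≈_ {A} {B})
    ∘-resp-≈   : ∀ {A B C} {f h : B ⇒ C} {g i : A ⇒ B} → f ≈ h → g ≈ i → f ∘ g ≈ h ∘ i
    assoc      : ∀ {A B C D} {f : A ⇒ B} {g : B ⇒ C} {h : C ⇒ D} → (h ∘ g) ∘ f ≈ h ∘ (g ∘ f)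
    identityˡ  : ∀ {A B} {f : A ⇒ B} → id ∘ f ≈ f
    identityʳ  : ∀ {A B} {f : A ⇒ B} → f ∘ id ≈ f

record SymmetricMonoidalCategory (o ℓ e : Level) : Set (suc (o ⊔ ℓ ⊔ e)) where
  field
    cat : Category o ℓ e
  open Category cat public
  infixr 10 _⊗₀_ _⊗₁_
  field
    _⊗₀_ : Obj → Obj → Obj
    _⊗₁_ : ∀ {A B C D} → A ⇒ B → C ⇒ D → (A ⊗₀ C) ⇒ (B ⊗₀ D)
    ⊗-identity : ∀ {A C} → (id {A} ⊗₁ id {C}) ≈ id
    ⊗-homomorphism : ∀ {A B C D E F} {f : A ⇒ B} {g : B ⇒ C} {h : D ⇒ E} {k : E ⇒ F} →
                     ((g ∘ f) ⊗₁ (k ∘ h)) ≈ (g ⊗₁ k) ∘ (f ⊗₁ h)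
    ⊗-resp-≈ : ∀ {A B C D} {f g : A ⇒ B} {h k : C ⇒ D} → f ≈ g → h ≈ k → (f ⊗₁ h) ≈ (g ⊗₁ k)
    K : Obj
    α   : ∀ A B C → (A ⊗₀ (B ⊗₀ C)) ⇒ ((A ⊗₀ B) ⊗₀ C)
    α⁻¹ : ∀ A B C → ((A ⊗₀ B) ⊗₀ C) ⇒ (A ⊗₀ (B ⊗₀ C))
    λu   : ∀ A → (K ⊗₀ A) ⇒ A
    λu⁻¹ : ∀ A → A ⇒ (K ⊗₀ A)
    ρu   : ∀ A → (A ⊗₀ K) ⇒ A
    ρu⁻¹ : ∀ A → A ⇒ (A ⊗₀ K)
    σ    : ∀ A B → (A ⊗₀ B) ⇒ (B ⊗₀ A)
    α-isoˡ : ∀ {A B C} → α⁻¹ A B C ∘ α A B C ≈ id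
    α-isoʳ : ∀ {A B C} → α A B C ∘ α⁻¹ A B C ≈ id
    λ-isoˡ : ∀ {A} → λu⁻¹ A ∘ λu A ≈ id
    λ-isoʳ : ∀ {A} → λu A ∘ λu⁻¹ A ≈ id
    ρ-isoˡ : ∀ {A} → ρu⁻¹ A ∘ ρu A ≈ id
    ρ-isoʳ : ∀ {A} → ρu A ∘ ρu⁻¹ A ≈ id
    σ-involutive : ∀ {A B} → σ B A ∘ σ A B ≈ id
    α-natural : ∀ {A A' B B' C C'} {f : A ⇒ A'} {g : B ⇒ B'} {h : C ⇒ C'} →
                α A' B' C' ∘ (f ⊗₁ (g ⊗₁ h)) ≈ ((f ⊗₁ g) ⊗₁ h) ∘ α A B C
    λ-natural : ∀ {A B} {f : A ⇒ B} → λu B ∘ (id ⊗₁ f) ≈ f ∘ λu A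
    ρ-natural : ∀ {A B} {f : A ⇒ B} → ρu B ∘ (f ⊗₁ id) ≈ f ∘ ρu A
    σ-natural : ∀ {A A' B B'} {f : A ⇒ A'} {g : B ⇒ B'} →
                σ A' B' ∘ (f ⊗₁ g) ≈ (g ⊗₁ f) ∘ σ A B
    pentagon : ∀ {A B C D} →
               α (A ⊗₀ B) C D ∘ α A B (C ⊗₀ D)
                 ≈ (α A B C ⊗₁ id) ∘ (α A (B ⊗₀ C) D ∘ (id ⊗₁ α B C D))
    triangle : ∀ {A B} → (ρu A ⊗₁ id) ∘ α A K B ≈ id ⊗₁ λu B
    hexagon  : ∀ {A B C} →
               α C A B ∘ (σ (A ⊗₀ B) C ∘ α A B C)
                 ≈ (σ A C ⊗₁ id) ∘ (α A C B ∘ (id ⊗₁ σ B C))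

  τ : ∀ A B C D → ((A ⊗₀ B) ⊗₀ (C ⊗₀ D)) ⇒ ((A ⊗₀ C) ⊗₀ (B ⊗₀ D))
  τ A B C D =
    α A C (B ⊗₀ D) ∘ ((id ⊗₁ α⁻¹ C B D) ∘ ((id ⊗₁ (σ B C ⊗₁ id)) ∘
      ((id ⊗₁ α B C D) ∘ α⁻¹ A B (C ⊗₀ D))))

record SymMonComonad {o ℓ e} (𝕏 : SymmetricMonoidalCategory o ℓ e) : Set (o ⊔ ℓ ⊔ e) where
  open SymmetricMonoidalCategory 𝕏
  field
    !₀ : Obj → Obj
    !₁ : ∀ {A B} → A ⇒ B → !₀ A ⇒ !₀ B
    !-identity : ∀ {A} → !₁ (id {A}) ≈ id
    !-homomorphism : ∀ {A B C} {f : A ⇒ B} {g : B ⇒ C} → !₁ (g ∘ f) ≈ !₁ g ∘ !₁ f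
    !-resp-≈ : ∀ {A B} {f g : A ⇒ B} → f ≈ g → !₁ f ≈ !₁ g
    δ : ∀ A → !₀ A ⇒ !₀ (!₀ A)
    ε : ∀ A → !₀ A ⇒ A
    δ-natural : ∀ {A B} {f : A ⇒ B} → δ B ∘ !₁ f ≈ !₁ (!₁ f) ∘ δ A
    ε-natural : ∀ {A B} {f : A ⇒ B} → ε B ∘ !₁ f ≈ f ∘ ε A
    coassoc   : ∀ {A} → δ (!₀ A) ∘ δ A ≈ !₁ (δ A) ∘ δ A
    counitˡ   : ∀ {A} → ε (!₀ A) ∘ δ A ≈ id
    counitʳ   : ∀ {A} → !₁ (ε A) ∘ δ A ≈ id
    m  : ∀ A B → (!₀ A ⊗₀ !₀ B) ⇒ !₀ (A ⊗₀ B)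
    mK : K ⇒ !₀ K
    m-natural : ∀ {A A' B B'} {f : A ⇒ A'} {g : B ⇒ B'} →
                m A' B' ∘ (!₁ f ⊗₁ !₁ g) ≈ !₁ (f ⊗₁ g) ∘ m A B
    m-assoc : ∀ {A B C} →
              !₁ (α A B C) ∘ (m A (B ⊗₀ C) ∘ (id ⊗₁ m B C))
                ≈ m (A ⊗₀ B) C ∘ ((m A B ⊗₁ id) ∘ α (!₀ A) (!₀ B) (!₀ C))
    m-unitˡ : ∀ {A} → !₁ (λu A) ∘ (m K A ∘ (mK ⊗₁ id)) ≈ λu (!₀ A)
    m-unitʳ : ∀ {A} → !₁ (ρu A) ∘ (m A K ∘ (id ⊗₁ mK)) ≈ ρu (!₀ A)
    m-symm  : ∀ {A B} → !₁ (σ A B) ∘ m A B ≈ m B A ∘ σ (!₀ A) (!₀ B)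
    δ-monoidal  : ∀ {A B} →
                  δ (A ⊗₀ B) ∘ m A B ≈ !₁ (m A B) ∘ (m (!₀ A) (!₀ B) ∘ (δ A ⊗₁ δ B))
    δ-monoidalK : δ K ∘ mK ≈ !₁ mK ∘ mK
    ε-monoidal  : ∀ {A B} → ε (A ⊗₀ B) ∘ m A B ≈ (ε A ⊗₁ ε B)
    ε-monoidalK : ε K ∘ mK ≈ id

module _ {o ℓ e} (𝕏 : SymmetricMonoidalCategory o ℓ e) where
  open SymmetricMonoidalCategory 𝕏

  record CocommBimonoid (A : Obj) : Set (ℓ ⊔ e) where
    field
      ∇  : (A ⊗₀ A) ⇒ A
      u  : K ⇒ A
      Δ  : A ⇒ (A ⊗₀ A)
      ec : A ⇒ K
      ∇-assoc  : ∇ ∘ ((∇ ⊗₁ id) ∘ α A A A) ≈ ∇ ∘ (id ⊗₁ ∇)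
      ∇-unitˡ  : ∇ ∘ (u ⊗₁ id) ≈ λu A
      ∇-unitʳ  : ∇ ∘ (id ⊗₁ u) ≈ ρu A
      Δ-assoc  : α A A A ∘ ((id ⊗₁ Δ) ∘ Δ) ≈ (Δ ⊗₁ id) ∘ Δ
      Δ-unitˡ  : λu A ∘ ((ec ⊗₁ id) ∘ Δ) ≈ id
      Δ-unitʳ  : ρu A ∘ ((id ⊗₁ ec) ∘ Δ) ≈ id
      Δ-cocomm : σ A A ∘ Δ ≈ Δ
      Δ-∇      : Δ ∘ ∇ ≈ (∇ ⊗₁ ∇) ∘ (τ A A A A ∘ (Δ ⊗₁ Δ))
      Δ-u      : Δ ∘ u ≈ (u ⊗₁ u) ∘ λu⁻¹ K
      ec-∇     : ec ∘ ∇ ≈ λu K ∘ (ec ⊗₁ ec)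
      ec-u     : ec ∘ u ≈ id

  module _ (Ω : SymMonComonad 𝕏) where
    open SymMonComonad Ω

    -- (1) A cocommutative bimonoid in the Eilenberg–Moore category 𝕏^!
    --     (with ⊗^m and unit (K, m_K)) whose underlying cocommutative
    --     bimonoid in 𝕏 is (A, B): a !-coalgebra structure ω on A such that
    --     all structure maps of B are coalgebra morphisms.
    record BimonoidInCoalgebras (A : Obj) (B : CocommBimonoid A) : Set (ℓ ⊔ e) where
      open CocommBimonoid B
      field
        ω : A ⇒ !₀ A
        ω-coassoc : δ A ∘ ω ≈ !₁ ω ∘ ω
        ω-counit  : ε A ∘ ω ≈ id
        ∇-coalg   : ω ∘ ∇ ≈ !₁ ∇ ∘ (m A A ∘ (ω ⊗₁ ω))
        u-coalg   : ω ∘ u ≈ !₁ u ∘ mK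
        Δ-coalg   : m A A ∘ ((ω ⊗₁ ω) ∘ Δ) ≈ !₁ Δ ∘ ω
        ec-coalg  : mK ∘ ec ≈ !₁ ec ∘ ω

    -- Symmetric monoidal mixed distributive law of a monad T with
    -- comonoidal structure (given by its raw data) over (!, δ, ε, m, m_K).
    record IsSymMonMixedDistLaw
      (T₀ : Obj → Obj) (T₁ : ∀ {X Y} → X ⇒ Y → T₀ X ⇒ T₀ Y)
      (μ : ∀ X → T₀ (T₀ X) ⇒ T₀ X) (η : ∀ X → X ⇒ T₀ X)
      (n : ∀ X Y → T₀ (X ⊗₀ Y) ⇒ (T₀ X ⊗₀ T₀ Y)) (nK : T₀ K ⇒ K)
      (lam : ∀ X → T₀ (!₀ X) ⇒ !₀ (T₀ X)) : Set (o ⊔ ℓ ⊔ e) where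
      field
        natural : ∀ {X Y} {f : X ⇒ Y} → lam Y ∘ T₁ (!₁ f) ≈ !₁ (T₁ f) ∘ lam X
        law-μ : ∀ {X} → lam X ∘ μ (!₀ X) ≈ !₁ (μ X) ∘ (lam (T₀ X) ∘ T₁ (lam X))
        law-η : ∀ {X} → lam X ∘ η (!₀ X) ≈ !₁ (η X)
        law-δ : ∀ {X} → δ (T₀ X) ∘ lam X ≈ !₁ (lam X) ∘ (lam (!₀ X) ∘ T₁ (δ X))
        law-ε : ∀ {X} → ε (T₀ X) ∘ lam X ≈ T₁ (ε X)
        law-m : ∀ {X Y} →
                !₁ (n X Y) ∘ (lam (X ⊗₀ Y) ∘ T₁ (m X Y))
                  ≈ m (T₀ X) (T₀ Y) ∘ ((lam X ⊗₁ lam Y) ∘ n (!₀ X) (!₀ Y))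
        law-mK : !₁ nK ∘ (lam K ∘ T₁ mK) ≈ mK ∘ nK

    record MixedDistLawFor (A : Obj) (B : CocommBimonoid A) : Set (o ⊔ ℓ ⊔ e) where
      open CocommBimonoid B
      T₀ : Obj → Obj
      T₀ X = A ⊗₀ X
      T₁ : ∀ {X Y} → X ⇒ Y → T₀ X ⇒ T₀ Y
      T₁ f = id ⊗₁ f
      μ∇ : ∀ X → T₀ (T₀ X) ⇒ T₀ X
      μ∇ X = (∇ ⊗₁ id) ∘ α A A X
      ηu : ∀ X → X ⇒ T₀ X
      ηu X = (u ⊗₁ id) ∘ λu⁻¹ X
      nΔ : ∀ X Y → T₀ (X ⊗₀ Y) ⇒ (T₀ X ⊗₀ T₀ Y)
      nΔ X Y = τ A A X Y ∘ (Δ ⊗₁ id)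
      ne : T₀ K ⇒ K
      ne = ec ∘ ρu A
      field
        lam : ∀ X → (A ⊗₀ !₀ X) ⇒ !₀ (A ⊗₀ X)
        isDistLaw : IsSymMonMixedDistLaw T₀ T₁ μ∇ ηu nΔ ne lam
        extra : ∀ {X Y} →
                !₁ (α A X Y) ∘ (lam (X ⊗₀ Y) ∘ (id ⊗₁ m X Y))
                  ≈ m (A ⊗₀ X) Y ∘ ((lam X ⊗₁ id) ∘ α A (!₀ X) (!₀ Y))

    -- Bijective correspondence between (1) and (2) over the same underlying
    -- cocommutative bimonoid (A, B): maps in both directions that are mutually
    -- inverse, where structures are compared by their data (ω, resp. λ_X for
    -- every X) up to the hom-setoid equality.
    record Correspondence (A : Obj) (B : CocommBimonoid A) : Set (o ⊔ ℓ ⊔ e) where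
      field
        to   : BimonoidInCoalgebras A B → MixedDistLawFor A B
        from : MixedDistLawFor A B → BimonoidInCoalgebras A B
        from∘to : ∀ c → BimonoidInCoalgebras.ω (from (to c)) ≈ BimonoidInCoalgebras.ω c
        to∘from : ∀ d X → MixedDistLawFor.lam (to (from d)) X ≈ MixedDistLawFor.lam d X

-- A coalgebra structure ω : A → !A gives λ_X = m_{A,X} ∘ (ω ⊗ 1), and a law λ gives back
-- ω = !(ρ_A) ∘ λ_K ∘ (1 ⊗ m_K) ∘ ρ_A⁻¹. Recovering ω from its λ is the right unit law of m.
-- Conversely, the extra axiom taken at K ⊗ X, together with the left unit law of m and the
-- naturality of λ, forces λ_X = m_{A,X} ∘ (ω ⊗ 1) for the ω built from λ.
-- For λ of this form each axiom of the distributive law rewrites to Φ_X(F) ≈ Φ_X(F′), where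
-- F ≈ F′ is the matching coalgebra condition on ω (coassociativity, counitality, or one of
-- ∇, u, Δ, e being a coalgebra morphism) and Φ_X is built from m, ⊗ and structural isomorphisms.
-- So the conditions give the laws; conversely Φ_K is injective, essentially because
-- F ↦ m_{W,K} ∘ (F ⊗ m_K) is split by !(ρ_W) ∘ - ∘ ρ⁻¹, so the laws at K give the conditions.

module Submission where

open import Level using (_⊔_)
open import Relation.Binary.Bundles using (Setoid)
import Relation.Binary.Reasoning.Setoid as SetoidReasoning
open import Defs

module CategoryReasoning {o ℓ e} (𝒞 : Category o ℓ e) where
  open Category 𝒞

  hom-setoid : Obj → Obj → Setoid ℓ e
  hom-setoid A B = record { Carrier = A ⇒ B ; _≈_ = _≈_ ; isEquivalence = ≈-equiv }

  module _ {A B : Obj} where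
    open Setoid (hom-setoid A B) public using (refl; sym; trans)
    open SetoidReasoning (hom-setoid A B) public

  private variable
    A B C D A' B' C' : Obj

  infixr 4 _⟩∘⟨_ refl⟩∘⟨_
  infixl 5 _⟩∘⟨refl

  _⟩∘⟨_ : ∀ {f h : B ⇒ C} {g i : A ⇒ B} → f ≈ h → g ≈ i → f ∘ g ≈ h ∘ i
  _⟩∘⟨_ = ∘-resp-≈

  refl⟩∘⟨_ : ∀ {f : B ⇒ C} {g i : A ⇒ B} → g ≈ i → f ∘ g ≈ f ∘ i
  refl⟩∘⟨ p = refl ⟩∘⟨ p

  _⟩∘⟨refl : ∀ {f h : B ⇒ C} {g : A ⇒ B} → f ≈ h → f ∘ g ≈ h ∘ g
  p ⟩∘⟨refl = p ⟩∘⟨ refl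

  sym-assoc : ∀ {f : A ⇒ B} {g : B ⇒ C} {h : C ⇒ D} → h ∘ (g ∘ f) ≈ (h ∘ g) ∘ f
  sym-assoc = sym assoc

  pullˡ : ∀ {f : A ⇒ B} {g : B ⇒ C} {h : C ⇒ D} {k : B ⇒ D} →
          h ∘ g ≈ k → h ∘ (g ∘ f) ≈ k ∘ f
  pullˡ p = trans sym-assoc (p ⟩∘⟨refl)

  pullʳ : ∀ {f : A ⇒ B} {g : B ⇒ C} {h : C ⇒ D} {k : A ⇒ C} →
          g ∘ f ≈ k → (h ∘ g) ∘ f ≈ h ∘ k
  pullʳ p = trans assoc (refl⟩∘⟨ p)

  cancelˡ : ∀ {f : A ⇒ B} {g : B ⇒ C} {h : C ⇒ B} → h ∘ g ≈ id → h ∘ (g ∘ f) ≈ f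
  cancelˡ p = trans (pullˡ p) identityˡ

  cancelʳ : ∀ {f : A ⇒ B} {g : B ⇒ A} {h : A ⇒ C} → g ∘ f ≈ id → (h ∘ g) ∘ f ≈ h
  cancelʳ p = trans (pullʳ p) identityʳ

  cancelInner : ∀ {f : A ⇒ B} {g : B ⇒ A} {h : A ⇒ C} {k : D ⇒ A} →
                g ∘ f ≈ id → (h ∘ g) ∘ (f ∘ k) ≈ h ∘ k
  cancelInner p = trans assoc (refl⟩∘⟨ cancelˡ p)

  glue : ∀ {a : A ⇒ B} {b : B ⇒ C} {x : A ⇒ A'} {y : B ⇒ B'} {z : C ⇒ C'}
           {a' : A' ⇒ B'} {b' : B' ⇒ C'} →
         b' ∘ y ≈ z ∘ b → a' ∘ x ≈ y ∘ a → (b' ∘ a') ∘ x ≈ z ∘ (b ∘ a)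
  glue p q = trans (pullʳ q) (trans sym-assoc (trans (p ⟩∘⟨refl) assoc))

  invert-square : ∀ {a : A ⇒ B} {a' : B ⇒ A} {b : C ⇒ D} {b' : D ⇒ C} {f : A ⇒ C} {g : B ⇒ D} →
                  a ∘ a' ≈ id → b' ∘ b ≈ id → b ∘ f ≈ g ∘ a → b' ∘ g ≈ f ∘ a'
  invert-square {a = a} {a'} {b} {b'} {f} {g} aa' b'b sq = begin
    b' ∘ g               ≈⟨ identityʳ ⟨
    (b' ∘ g) ∘ id        ≈⟨ refl⟩∘⟨ aa' ⟨
    (b' ∘ g) ∘ (a ∘ a')  ≈⟨ trans assoc (refl⟩∘⟨ sym-assoc) ⟩
    b' ∘ ((g ∘ a) ∘ a')  ≈⟨ refl⟩∘⟨ sq ⟩∘⟨refl ⟨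
    b' ∘ ((b ∘ f) ∘ a')  ≈⟨ refl⟩∘⟨ assoc ⟩
    b' ∘ (b ∘ (f ∘ a'))  ≈⟨ cancelˡ b'b ⟩
    f ∘ a'               ∎

  split-mono-cancel : ∀ {t : B ⇒ C} {r : C ⇒ B} {f g : A ⇒ B} →
                      r ∘ t ≈ id → t ∘ f ≈ t ∘ g → f ≈ g
  split-mono-cancel rt p = trans (sym (cancelˡ rt)) (trans (refl⟩∘⟨ p) (cancelˡ rt))

  split-epi-cancel : ∀ {t : A ⇒ B} {s : B ⇒ A} {f g : B ⇒ C} →
                     t ∘ s ≈ id → f ∘ t ≈ g ∘ t → f ≈ g
  split-epi-cancel ts p = trans (sym (cancelʳ ts)) (trans (p ⟩∘⟨refl) (cancelʳ ts))

module MonoidalReasoning {o ℓ e} (𝕏 : SymmetricMonoidalCategory o ℓ e) where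
  open SymmetricMonoidalCategory 𝕏
  open CategoryReasoning cat public

  private variable
    A B C D A' B' C' D' : Obj

  infixr 4 _⟩⊗⟨_

  _⟩⊗⟨_ : ∀ {f g : A ⇒ B} {h k : C ⇒ D} → f ≈ g → h ≈ k → (f ⊗₁ h) ≈ (g ⊗₁ k)
  _⟩⊗⟨_ = ⊗-resp-≈

  ⊗∘⊗ : ∀ {f : B ⇒ C} {g : A ⇒ B} {h : B' ⇒ C'} {k : A' ⇒ B'} →
        (f ⊗₁ h) ∘ (g ⊗₁ k) ≈ (f ∘ g) ⊗₁ (h ∘ k)
  ⊗∘⊗ = sym ⊗-homomorphism

  id⊗∘id⊗ : ∀ {f : B ⇒ C} {g : A ⇒ B} → (id {D} ⊗₁ f) ∘ (id ⊗₁ g) ≈ id ⊗₁ (f ∘ g)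
  id⊗∘id⊗ = trans ⊗∘⊗ (identityˡ ⟩⊗⟨ refl)

  ⊗id∘⊗id : ∀ {f : B ⇒ C} {g : A ⇒ B} → (f ⊗₁ id {D}) ∘ (g ⊗₁ id) ≈ (f ∘ g) ⊗₁ id
  ⊗id∘⊗id = trans ⊗∘⊗ (refl ⟩⊗⟨ identityˡ)

  serialize₁₂ : ∀ {f : A ⇒ B} {g : C ⇒ D} → f ⊗₁ g ≈ (f ⊗₁ id) ∘ (id ⊗₁ g)
  serialize₁₂ = trans (sym identityʳ ⟩⊗⟨ sym identityˡ) ⊗-homomorphism

  serialize₂₁ : ∀ {f : A ⇒ B} {g : C ⇒ D} → f ⊗₁ g ≈ (id ⊗₁ g) ∘ (f ⊗₁ id)
  serialize₂₁ = trans (sym identityˡ ⟩⊗⟨ sym identityʳ) ⊗-homomorphism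

  slide-⊗ : ∀ {f : A ⇒ B} {g : C ⇒ D} → (f ⊗₁ id) ∘ (id ⊗₁ g) ≈ (id ⊗₁ g) ∘ (f ⊗₁ id)
  slide-⊗ = trans (sym serialize₁₂) serialize₂₁

  id⊗-inverse : ∀ {f : A ⇒ B} {g : B ⇒ A} → f ∘ g ≈ id → (id {D} ⊗₁ f) ∘ (id ⊗₁ g) ≈ id
  id⊗-inverse p = trans id⊗∘id⊗ (trans (refl ⟩⊗⟨ p) ⊗-identity)

  ⊗id-inverse : ∀ {f : A ⇒ B} {g : B ⇒ A} → f ∘ g ≈ id → (f ⊗₁ id {D}) ∘ (g ⊗₁ id) ≈ id
  ⊗id-inverse p = trans ⊗id∘⊗id (trans (p ⟩⊗⟨ refl) ⊗-identity)

  id⊗-square : ∀ {p : A ⇒ B} {x : A ⇒ A'} {y : B ⇒ B'} {p' : A' ⇒ B'} {f : C ⇒ D} →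
               p' ∘ x ≈ y ∘ p → (id ⊗₁ p') ∘ (f ⊗₁ x) ≈ (f ⊗₁ y) ∘ (id ⊗₁ p)
  id⊗-square sq = trans ⊗∘⊗ (trans (trans identityˡ (sym identityʳ) ⟩⊗⟨ sq) ⊗-homomorphism)

  ⊗id-square : ∀ {p : A ⇒ B} {x : A ⇒ A'} {y : B ⇒ B'} {p' : A' ⇒ B'} {f : C ⇒ D} →
               p' ∘ x ≈ y ∘ p → (p' ⊗₁ id) ∘ (x ⊗₁ f) ≈ (y ⊗₁ f) ∘ (p ⊗₁ id)
  ⊗id-square sq = trans ⊗∘⊗ (trans (sq ⟩⊗⟨ trans identityˡ (sym identityʳ)) ⊗-homomorphism)

  α⁻¹-natural : ∀ {f : A ⇒ A'} {g : B ⇒ B'} {h : C ⇒ C'} →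
                α⁻¹ A' B' C' ∘ ((f ⊗₁ g) ⊗₁ h) ≈ (f ⊗₁ (g ⊗₁ h)) ∘ α⁻¹ A B C
  α⁻¹-natural = invert-square α-isoʳ α-isoˡ α-natural

  λ⁻¹-natural : ∀ {f : A ⇒ B} → λu⁻¹ B ∘ f ≈ (id ⊗₁ f) ∘ λu⁻¹ A
  λ⁻¹-natural = invert-square λ-isoʳ λ-isoˡ λ-natural

  triangle⁻¹ : ∀ {A B} → α A K B ∘ (id ⊗₁ λu⁻¹ B) ≈ ρu⁻¹ A ⊗₁ id
  triangle⁻¹ {A} {B} = begin
    α A K B ∘ (id ⊗₁ λu⁻¹ B)
      ≈⟨ cancelˡ (⊗id-inverse ρ-isoˡ) ⟨
    (ρu⁻¹ A ⊗₁ id) ∘ ((ρu A ⊗₁ id) ∘ (α A K B ∘ (id ⊗₁ λu⁻¹ B)))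
      ≈⟨ refl⟩∘⟨ pullˡ triangle ⟩
    (ρu⁻¹ A ⊗₁ id) ∘ ((id ⊗₁ λu B) ∘ (id ⊗₁ λu⁻¹ B))
      ≈⟨ refl⟩∘⟨ id⊗-inverse λ-isoʳ ⟩
    (ρu⁻¹ A ⊗₁ id) ∘ id
      ≈⟨ identityʳ ⟩
    ρu⁻¹ A ⊗₁ id ∎

  τ-natural : ∀ {f : A ⇒ A'} {g : B ⇒ B'} {h : C ⇒ C'} {k : D ⇒ D'} →
              τ A' B' C' D' ∘ ((f ⊗₁ g) ⊗₁ (h ⊗₁ k)) ≈ ((f ⊗₁ h) ⊗₁ (g ⊗₁ k)) ∘ τ A B C D
  τ-natural = glue α-natural (glue (id⊗-square α⁻¹-natural)
                (glue (id⊗-square (⊗id-square σ-natural))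
                (glue (id⊗-square α-natural) α⁻¹-natural)))

  τ-involutive : ∀ {A B C D} → τ A C B D ∘ τ A B C D ≈ id
  τ-involutive =
    trans (trans sym-assoc (trans sym-assoc sym-assoc) ⟩∘⟨refl)
      (trans (cancelInner α-isoˡ) (trans (cancelInner (id⊗-inverse α-isoʳ))
      (trans (cancelInner (id⊗-inverse (⊗id-inverse σ-involutive)))
      (trans (cancelInner (id⊗-inverse α-isoˡ)) α-isoʳ))))

module ComonadReasoning {o ℓ e} (𝕏 : SymmetricMonoidalCategory o ℓ e) (Ω : SymMonComonad 𝕏) where
  open SymmetricMonoidalCategory 𝕏
  open SymMonComonad Ω
  open MonoidalReasoning 𝕏

  private variable
    A B C D A' B' W X Y Z : Obj

  !∘! : ∀ {f : A ⇒ B} {g : B ⇒ C} → !₁ g ∘ !₁ f ≈ !₁ (g ∘ f)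
  !∘! = sym !-homomorphism

  !-inverse : ∀ {f : A ⇒ B} {g : B ⇒ A} → f ∘ g ≈ id → !₁ f ∘ !₁ g ≈ id
  !-inverse p = trans !∘! (trans (!-resp-≈ p) !-identity)

  m-naturalˡ : ∀ {f : A ⇒ A'} → m A' B ∘ (!₁ f ⊗₁ id) ≈ !₁ (f ⊗₁ id) ∘ m A B
  m-naturalˡ = trans (refl⟩∘⟨ (refl ⟩⊗⟨ sym !-identity)) m-natural

  m-naturalʳ : ∀ {f : B ⇒ B'} → m A B' ∘ (id ⊗₁ !₁ f) ≈ !₁ (id ⊗₁ f) ∘ m A B
  m-naturalʳ = trans (refl⟩∘⟨ (sym !-identity ⟩⊗⟨ refl)) m-natural

  m-assoc′ : ∀ {A B C} → !₁ (α A B C) ∘ (m A (B ⊗₀ C) ∘ (id ⊗₁ m B C))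
               ≈ (m (A ⊗₀ B) C ∘ (m A B ⊗₁ id)) ∘ α (!₀ A) (!₀ B) (!₀ C)
  m-assoc′ = trans m-assoc sym-assoc

  m-assoc⁻¹ : ∀ {A B C} → !₁ (α⁻¹ A B C) ∘ (m (A ⊗₀ B) C ∘ (m A B ⊗₁ id))
                ≈ (m A (B ⊗₀ C) ∘ (id ⊗₁ m B C)) ∘ α⁻¹ (!₀ A) (!₀ B) (!₀ C)
  m-assoc⁻¹ = invert-square α-isoʳ (!-inverse α-isoˡ) m-assoc′

  m-unitˡ⁻¹ : ∀ {X} → m K X ∘ ((mK ⊗₁ id) ∘ λu⁻¹ (!₀ X)) ≈ !₁ (λu⁻¹ X)
  m-unitˡ⁻¹ {X} = begin
    m K X ∘ ((mK ⊗₁ id) ∘ λu⁻¹ (!₀ X))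
      ≈⟨ cancelˡ (!-inverse λ-isoˡ) ⟨
    !₁ (λu⁻¹ X) ∘ (!₁ (λu X) ∘ (m K X ∘ ((mK ⊗₁ id) ∘ λu⁻¹ (!₀ X))))
      ≈⟨ refl⟩∘⟨ trans (refl⟩∘⟨ sym-assoc) (pullˡ m-unitˡ) ⟩
    !₁ (λu⁻¹ X) ∘ (λu (!₀ X) ∘ λu⁻¹ (!₀ X))
      ≈⟨ trans (refl⟩∘⟨ λ-isoʳ) identityʳ ⟩
    !₁ (λu⁻¹ X) ∎

  m-unitʳ-recovers : ∀ {F : Z ⇒ !₀ W} → !₁ (ρu W) ∘ (m W K ∘ ((F ⊗₁ mK) ∘ ρu⁻¹ Z)) ≈ F
  m-unitʳ-recovers {Z} {W} {F} = begin
    !₁ (ρu W) ∘ (m W K ∘ ((F ⊗₁ mK) ∘ ρu⁻¹ Z))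
      ≈⟨ refl⟩∘⟨ refl⟩∘⟨ trans (serialize₂₁ ⟩∘⟨refl) assoc ⟩
    !₁ (ρu W) ∘ (m W K ∘ ((id ⊗₁ mK) ∘ ((F ⊗₁ id) ∘ ρu⁻¹ Z)))
      ≈⟨ trans sym-assoc (trans sym-assoc (trans assoc m-unitʳ ⟩∘⟨refl)) ⟩
    ρu (!₀ W) ∘ ((F ⊗₁ id) ∘ ρu⁻¹ Z)
      ≈⟨ pullˡ ρ-natural ⟩
    (F ∘ ρu Z) ∘ ρu⁻¹ Z
      ≈⟨ cancelʳ ρ-isoʳ ⟩
    F ∎

  m-⊗mK-injective : ∀ {F G : Z ⇒ !₀ W} → m W K ∘ (F ⊗₁ mK) ≈ m W K ∘ (G ⊗₁ mK) → F ≈ G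
  m-⊗mK-injective {F = F} {G} p = begin
    F                                          ≈⟨ m-unitʳ-recovers ⟨
    !₁ (ρu _) ∘ (m _ K ∘ ((F ⊗₁ mK) ∘ ρu⁻¹ _))  ≈⟨ refl⟩∘⟨ trans sym-assoc (trans (p ⟩∘⟨refl) assoc) ⟩
    !₁ (ρu _) ∘ (m _ K ∘ ((G ⊗₁ mK) ∘ ρu⁻¹ _))  ≈⟨ m-unitʳ-recovers ⟩
    G                                          ∎

  m-⊗id-injective : ∀ {F G : Z ⇒ !₀ W} → m W K ∘ (F ⊗₁ id) ≈ m W K ∘ (G ⊗₁ id) → F ≈ G
  m-⊗id-injective p = m-⊗mK-injective (trans (refl⟩∘⟨ serialize₁₂)
    (trans sym-assoc (trans (p ⟩∘⟨refl) (trans assoc (refl⟩∘⟨ sym serialize₁₂)))))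

  m-λ⁻¹-K : m K K ∘ ((mK ⊗₁ mK) ∘ λu⁻¹ K) ≈ !₁ (λu⁻¹ K) ∘ mK
  m-λ⁻¹-K = begin
    m K K ∘ ((mK ⊗₁ mK) ∘ λu⁻¹ K)                  ≈⟨ refl⟩∘⟨ trans (serialize₁₂ ⟩∘⟨refl) assoc ⟩
    m K K ∘ ((mK ⊗₁ id) ∘ ((id ⊗₁ mK) ∘ λu⁻¹ K))    ≈⟨ refl⟩∘⟨ refl⟩∘⟨ λ⁻¹-natural ⟨
    m K K ∘ ((mK ⊗₁ id) ∘ (λu⁻¹ (!₀ K) ∘ mK))       ≈⟨ trans (refl⟩∘⟨ sym-assoc) sym-assoc ⟩
    (m K K ∘ ((mK ⊗₁ id) ∘ λu⁻¹ (!₀ K))) ∘ mK       ≈⟨ m-unitˡ⁻¹ ⟩∘⟨refl ⟩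
    !₁ (λu⁻¹ K) ∘ mK                                ∎

  m-⊗mKK-reduces : ∀ {F : Z ⇒ !₀ W} →
                   m W (K ⊗₀ K) ∘ ((F ⊗₁ m K K) ∘ (id ⊗₁ ((mK ⊗₁ mK) ∘ λu⁻¹ K)))
                     ≈ !₁ (id ⊗₁ λu⁻¹ K) ∘ (m W K ∘ (F ⊗₁ mK))
  m-⊗mKK-reduces {F = F} = begin
    m _ (K ⊗₀ K) ∘ ((F ⊗₁ m K K) ∘ (id ⊗₁ ((mK ⊗₁ mK) ∘ λu⁻¹ K)))
      ≈⟨ refl⟩∘⟨ trans ⊗∘⊗ (identityʳ ⟩⊗⟨ m-λ⁻¹-K) ⟩
    m _ (K ⊗₀ K) ∘ (F ⊗₁ (!₁ (λu⁻¹ K) ∘ mK))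
      ≈⟨ refl⟩∘⟨ trans (sym identityˡ ⟩⊗⟨ refl) ⊗-homomorphism ⟩
    m _ (K ⊗₀ K) ∘ ((id ⊗₁ !₁ (λu⁻¹ K)) ∘ (F ⊗₁ mK))
      ≈⟨ pullˡ m-naturalʳ ⟩
    (!₁ (id ⊗₁ λu⁻¹ K) ∘ m _ K) ∘ (F ⊗₁ mK)
      ≈⟨ assoc ⟩
    !₁ (id ⊗₁ λu⁻¹ K) ∘ (m _ K ∘ (F ⊗₁ mK)) ∎

  m-⊗mKK-injective : ∀ {F G : Z ⇒ !₀ W} →
                     m W (K ⊗₀ K) ∘ (F ⊗₁ m K K) ≈ m W (K ⊗₀ K) ∘ (G ⊗₁ m K K) → F ≈ G
  m-⊗mKK-injective p = m-⊗mK-injective (split-mono-cancel (!-inverse (id⊗-inverse λ-isoʳ))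
    (trans (sym m-⊗mKK-reduces) (trans sym-assoc (trans (p ⟩∘⟨refl) (trans assoc m-⊗mKK-reduces)))))

  m-⊗δ-reduces : ∀ {F : Z ⇒ !₀ (!₀ W)} →
                 !₁ (!₁ (ρu W)) ∘ ((!₁ (m W K) ∘ (m (!₀ W) (!₀ K) ∘ (F ⊗₁ δ K))) ∘ (id ⊗₁ mK))
                   ≈ !₁ (ρu (!₀ W)) ∘ (m (!₀ W) K ∘ (F ⊗₁ mK))
  m-⊗δ-reduces {W = W} {F = F} = begin
    !₁ (!₁ (ρu W)) ∘ ((!₁ (m W K) ∘ (m (!₀ W) (!₀ K) ∘ (F ⊗₁ δ K))) ∘ (id ⊗₁ mK))
      ≈⟨ refl⟩∘⟨ trans assoc (refl⟩∘⟨ trans assoc (refl⟩∘⟨ trans ⊗∘⊗ (identityʳ ⟩⊗⟨ δ-monoidalK))) ⟩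
    !₁ (!₁ (ρu W)) ∘ (!₁ (m W K) ∘ (m (!₀ W) (!₀ K) ∘ (F ⊗₁ (!₁ mK ∘ mK))))
      ≈⟨ refl⟩∘⟨ refl⟩∘⟨ refl⟩∘⟨ trans (sym identityˡ ⟩⊗⟨ refl) ⊗-homomorphism ⟩
    !₁ (!₁ (ρu W)) ∘ (!₁ (m W K) ∘ (m (!₀ W) (!₀ K) ∘ ((id ⊗₁ !₁ mK) ∘ (F ⊗₁ mK))))
      ≈⟨ refl⟩∘⟨ refl⟩∘⟨ pullˡ m-naturalʳ ⟩
    !₁ (!₁ (ρu W)) ∘ (!₁ (m W K) ∘ ((!₁ (id ⊗₁ mK) ∘ m (!₀ W) K) ∘ (F ⊗₁ mK)))
      ≈⟨ trans (refl⟩∘⟨ trans (refl⟩∘⟨ assoc) sym-assoc) sym-assoc ⟩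
    (!₁ (!₁ (ρu W)) ∘ (!₁ (m W K) ∘ !₁ (id ⊗₁ mK))) ∘ (m (!₀ W) K ∘ (F ⊗₁ mK))
      ≈⟨ trans (refl⟩∘⟨ !∘!) !∘! ⟩∘⟨refl ⟩
    !₁ (!₁ (ρu W) ∘ (m W K ∘ (id ⊗₁ mK))) ∘ (m (!₀ W) K ∘ (F ⊗₁ mK))
      ≈⟨ !-resp-≈ m-unitʳ ⟩∘⟨refl ⟩
    !₁ (ρu (!₀ W)) ∘ (m (!₀ W) K ∘ (F ⊗₁ mK)) ∎

  m-⊗δ-injective : ∀ {F G : Z ⇒ !₀ (!₀ W)} →
                   !₁ (m W K) ∘ (m (!₀ W) (!₀ K) ∘ (F ⊗₁ δ K))
                     ≈ !₁ (m W K) ∘ (m (!₀ W) (!₀ K) ∘ (G ⊗₁ δ K)) → F ≈ G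
  m-⊗δ-injective p = m-⊗mK-injective (split-mono-cancel (!-inverse ρ-isoˡ)
    (trans (sym m-⊗δ-reduces) (trans (refl⟩∘⟨ (p ⟩∘⟨refl)) m-⊗δ-reduces)))

  ⊗ε-injective : ∀ {f g : Z ⇒ A} → f ⊗₁ ε K ≈ g ⊗₁ ε K → f ≈ g
  ⊗ε-injective {f = f} {g} p = trans (sym (recover f)) (trans (refl⟩∘⟨ (p ⟩∘⟨refl)) (recover g))
    where
    recover : ∀ (h : Z ⇒ A) → ρu A ∘ ((h ⊗₁ ε K) ∘ ((id ⊗₁ mK) ∘ ρu⁻¹ Z)) ≈ h
    recover h = trans (refl⟩∘⟨ trans sym-assoc (trans ⊗∘⊗ (identityʳ ⟩⊗⟨ ε-monoidalK) ⟩∘⟨refl))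
                  (trans (pullˡ ρ-natural) (cancelʳ ρ-isoʳ))

  !-glue : ∀ {a : A ⇒ B} {b : B ⇒ C} {M₀ : W ⇒ !₀ A} {M₁ : X ⇒ !₀ B} {M₂ : Y ⇒ !₀ C}
             {a' : W ⇒ X} {b' : X ⇒ Y} →
           !₁ b ∘ M₁ ≈ M₂ ∘ b' → !₁ a ∘ M₀ ≈ M₁ ∘ a' → !₁ (b ∘ a) ∘ M₀ ≈ M₂ ∘ (b' ∘ a')
  !-glue p q = trans (!-homomorphism ⟩∘⟨refl) (glue p q)

  m-id⊗-lift : ∀ {f : B ⇒ B'} {g : C ⇒ !₀ B} {g' : D ⇒ !₀ B'} {h : C ⇒ D} →
               !₁ f ∘ g ≈ g' ∘ h →
               !₁ (id {A} ⊗₁ f) ∘ (m A B ∘ (id ⊗₁ g)) ≈ (m A B' ∘ (id ⊗₁ g')) ∘ (id ⊗₁ h)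
  m-id⊗-lift p = trans sym-assoc (trans (sym m-naturalʳ ⟩∘⟨refl)
    (trans assoc (trans (refl⟩∘⟨ trans id⊗∘id⊗ (trans (refl ⟩⊗⟨ p) (sym id⊗∘id⊗))) sym-assoc)))

  m-σ⊗id : ∀ {A B C} → !₁ (σ A B ⊗₁ id {C}) ∘ (m (A ⊗₀ B) C ∘ (m A B ⊗₁ id))
             ≈ (m (B ⊗₀ A) C ∘ (m B A ⊗₁ id)) ∘ (σ (!₀ A) (!₀ B) ⊗₁ id)
  m-σ⊗id = trans sym-assoc (trans (sym m-naturalˡ ⟩∘⟨refl)
    (trans assoc (trans (refl⟩∘⟨ trans ⊗id∘⊗id (trans (m-symm ⟩⊗⟨ refl) (sym ⊗id∘⊗id))) sym-assoc)))

  m-τ : ∀ {A B C D} → !₁ (τ A B C D) ∘ (m (A ⊗₀ B) (C ⊗₀ D) ∘ (m A B ⊗₁ m C D))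
          ≈ (m (A ⊗₀ C) (B ⊗₀ D) ∘ (m A C ⊗₁ m B D)) ∘ τ (!₀ A) (!₀ B) (!₀ C) (!₀ D)
  m-τ = !-glue m-α-merge (!-glue (m-id⊗-lift m-assoc⁻¹) (!-glue (m-id⊗-lift m-σ⊗id)
          (!-glue (m-id⊗-lift m-assoc′) m-α⁻¹-split)))
    where
    m-α⁻¹-split : ∀ {A B C D} →
                  !₁ (α⁻¹ A B (C ⊗₀ D)) ∘ (m (A ⊗₀ B) (C ⊗₀ D) ∘ (m A B ⊗₁ m C D))
                    ≈ (m A (B ⊗₀ (C ⊗₀ D)) ∘ (id ⊗₁ (m B (C ⊗₀ D) ∘ (id ⊗₁ m C D))))
                        ∘ α⁻¹ (!₀ A) (!₀ B) (!₀ C ⊗₀ !₀ D)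
    m-α⁻¹-split {A} {B} {C} {D} = begin
      !₁ (α⁻¹ A B (C ⊗₀ D)) ∘ (m (A ⊗₀ B) (C ⊗₀ D) ∘ (m A B ⊗₁ m C D))
        ≈⟨ refl⟩∘⟨ trans (refl⟩∘⟨ serialize₁₂) sym-assoc ⟩
      !₁ (α⁻¹ A B (C ⊗₀ D)) ∘ ((m (A ⊗₀ B) (C ⊗₀ D) ∘ (m A B ⊗₁ id)) ∘ (id ⊗₁ m C D))
        ≈⟨ trans sym-assoc (m-assoc⁻¹ ⟩∘⟨refl) ⟩
      ((m A (B ⊗₀ (C ⊗₀ D)) ∘ (id ⊗₁ m B (C ⊗₀ D))) ∘ α⁻¹ _ _ _) ∘ (id ⊗₁ m C D)
        ≈⟨ pullʳ (trans (refl⟩∘⟨ (sym ⊗-identity ⟩⊗⟨ refl)) α⁻¹-natural) ⟩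
      (m A (B ⊗₀ (C ⊗₀ D)) ∘ (id ⊗₁ m B (C ⊗₀ D))) ∘ ((id ⊗₁ (id ⊗₁ m C D)) ∘ α⁻¹ _ _ _)
        ≈⟨ trans sym-assoc (pullʳ id⊗∘id⊗ ⟩∘⟨refl) ⟩
      (m A (B ⊗₀ (C ⊗₀ D)) ∘ (id ⊗₁ (m B (C ⊗₀ D) ∘ (id ⊗₁ m C D)))) ∘ α⁻¹ _ _ _ ∎
    m-α-merge : ∀ {A B C D} →
                !₁ (α A C (B ⊗₀ D)) ∘ (m A (C ⊗₀ (B ⊗₀ D)) ∘ (id ⊗₁ (m C (B ⊗₀ D) ∘ (id ⊗₁ m B D))))
                  ≈ (m (A ⊗₀ C) (B ⊗₀ D) ∘ (m A C ⊗₁ m B D)) ∘ α (!₀ A) (!₀ C) (!₀ B ⊗₀ !₀ D)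
    m-α-merge {A} {B} {C} {D} = begin
      !₁ (α A C (B ⊗₀ D)) ∘ (m A (C ⊗₀ (B ⊗₀ D)) ∘ (id ⊗₁ (m C (B ⊗₀ D) ∘ (id ⊗₁ m B D))))
        ≈⟨ refl⟩∘⟨ trans (refl⟩∘⟨ sym id⊗∘id⊗) sym-assoc ⟩
      !₁ (α A C (B ⊗₀ D)) ∘ ((m A (C ⊗₀ (B ⊗₀ D)) ∘ (id ⊗₁ m C (B ⊗₀ D))) ∘ (id ⊗₁ (id ⊗₁ m B D)))
        ≈⟨ trans sym-assoc (m-assoc′ ⟩∘⟨refl) ⟩
      ((m (A ⊗₀ C) (B ⊗₀ D) ∘ (m A C ⊗₁ id)) ∘ α _ _ _) ∘ (id ⊗₁ (id ⊗₁ m B D))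
        ≈⟨ pullʳ α-natural ⟩
      (m (A ⊗₀ C) (B ⊗₀ D) ∘ (m A C ⊗₁ id)) ∘ (((id ⊗₁ id) ⊗₁ m B D) ∘ α _ _ _)
        ≈⟨ trans sym-assoc (pullʳ (trans (refl⟩∘⟨ (⊗-identity ⟩⊗⟨ refl)) (sym serialize₁₂)) ⟩∘⟨refl) ⟩
      (m (A ⊗₀ C) (B ⊗₀ D) ∘ (m A C ⊗₁ m B D)) ∘ α _ _ _ ∎

module CoalgebrasAndLaws {o ℓ e} (𝕏 : SymmetricMonoidalCategory o ℓ e) (Ω : SymMonComonad 𝕏)
                         (A : SymmetricMonoidalCategory.Obj 𝕏) where
  open SymmetricMonoidalCategory 𝕏
  open SymMonComonad Ω
  open MonoidalReasoning 𝕏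
  open ComonadReasoning 𝕏 Ω

  Lam : Set (o ⊔ ℓ)
  Lam = ∀ X → (A ⊗₀ !₀ X) ⇒ !₀ (A ⊗₀ X)

  lam-of : A ⇒ !₀ A → Lam
  lam-of ω X = m A X ∘ (ω ⊗₁ id)

  coalg-of : Lam → A ⇒ !₀ A
  coalg-of lam = !₁ (ρu A) ∘ (lam K ∘ ((id ⊗₁ mK) ∘ ρu⁻¹ A))

  coalg-of-lam-of : ∀ ω → coalg-of (lam-of ω) ≈ ω
  coalg-of-lam-of ω = trans (refl⟩∘⟨ trans assoc (refl⟩∘⟨ trans sym-assoc (sym serialize₁₂ ⟩∘⟨refl)))
                        m-unitʳ-recovers

  lam-of-natural : ∀ {ω X Y} {f : X ⇒ Y} → lam-of ω Y ∘ (id ⊗₁ !₁ f) ≈ !₁ (id ⊗₁ f) ∘ lam-of ω X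
  lam-of-natural = trans (pullʳ slide-⊗) (trans sym-assoc (trans (m-naturalʳ ⟩∘⟨refl) assoc))

  lam-of-extra : ∀ {ω X Y} → !₁ (α A X Y) ∘ (lam-of ω (X ⊗₀ Y) ∘ (id ⊗₁ m X Y))
                   ≈ m (A ⊗₀ X) Y ∘ ((lam-of ω X ⊗₁ id) ∘ α A (!₀ X) (!₀ Y))
  lam-of-extra {ω} {X} {Y} = begin
    !₁ (α A X Y) ∘ ((m A (X ⊗₀ Y) ∘ (ω ⊗₁ id)) ∘ (id ⊗₁ m X Y))
      ≈⟨ refl⟩∘⟨ trans (pullʳ slide-⊗) sym-assoc ⟩
    !₁ (α A X Y) ∘ ((m A (X ⊗₀ Y) ∘ (id ⊗₁ m X Y)) ∘ (ω ⊗₁ id))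
      ≈⟨ trans sym-assoc (m-assoc′ ⟩∘⟨ (refl ⟩⊗⟨ sym ⊗-identity)) ⟩
    ((m (A ⊗₀ X) Y ∘ (m A X ⊗₁ id)) ∘ α _ _ _) ∘ (ω ⊗₁ (id ⊗₁ id))
      ≈⟨ pullʳ α-natural ⟩
    (m (A ⊗₀ X) Y ∘ (m A X ⊗₁ id)) ∘ (((ω ⊗₁ id) ⊗₁ id) ∘ α _ _ _)
      ≈⟨ trans assoc (refl⟩∘⟨ trans sym-assoc (⊗id∘⊗id ⟩∘⟨refl)) ⟩
    m (A ⊗₀ X) Y ∘ ((lam-of ω X ⊗₁ id) ∘ α A (!₀ X) (!₀ Y)) ∎

  lam-of-coalg-of-unfold : ∀ {lam : Lam} {Y} →
    lam-of (coalg-of lam) Y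
      ≈ !₁ (ρu A ⊗₁ id) ∘ ((m (A ⊗₀ K) Y ∘ ((lam K ⊗₁ id) ∘ α A (!₀ K) (!₀ Y)))
                            ∘ (id ⊗₁ ((mK ⊗₁ id) ∘ λu⁻¹ (!₀ Y))))
  lam-of-coalg-of-unfold {lam} {Y} = begin
    m A Y ∘ ((!₁ (ρu A) ∘ (lam K ∘ ((id ⊗₁ mK) ∘ ρu⁻¹ A))) ⊗₁ id)
      ≈⟨ refl⟩∘⟨ trans (sym ⊗id∘⊗id) (refl⟩∘⟨ trans (sym ⊗id∘⊗id) (refl⟩∘⟨ sym ⊗id∘⊗id)) ⟩
    m A Y ∘ ((!₁ (ρu A) ⊗₁ id) ∘ ((lam K ⊗₁ id) ∘ (((id ⊗₁ mK) ⊗₁ id) ∘ (ρu⁻¹ A ⊗₁ id))))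
      ≈⟨ trans sym-assoc (m-naturalˡ ⟩∘⟨refl) ⟩
    (!₁ (ρu A ⊗₁ id) ∘ m _ Y) ∘ ((lam K ⊗₁ id) ∘ (((id ⊗₁ mK) ⊗₁ id) ∘ (ρu⁻¹ A ⊗₁ id)))
      ≈⟨ trans assoc (refl⟩∘⟨ refl⟩∘⟨ refl⟩∘⟨ refl⟩∘⟨ sym triangle⁻¹) ⟩
    !₁ (ρu A ⊗₁ id) ∘ (m _ Y ∘ ((lam K ⊗₁ id) ∘ (((id ⊗₁ mK) ⊗₁ id)
                                              ∘ (α A K (!₀ Y) ∘ (id ⊗₁ λu⁻¹ (!₀ Y))))))
      ≈⟨ refl⟩∘⟨ refl⟩∘⟨ refl⟩∘⟨ trans (pullˡ (sym α-natural)) (trans assoc (refl⟩∘⟨ id⊗∘id⊗)) ⟩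
    !₁ (ρu A ⊗₁ id) ∘ (m _ Y ∘ ((lam K ⊗₁ id) ∘ (α _ _ _ ∘ (id ⊗₁ ((mK ⊗₁ id) ∘ λu⁻¹ (!₀ Y))))))
      ≈⟨ refl⟩∘⟨ trans (refl⟩∘⟨ sym-assoc) sym-assoc ⟩
    !₁ (ρu A ⊗₁ id) ∘ ((m _ Y ∘ ((lam K ⊗₁ id) ∘ α _ _ _)) ∘ (id ⊗₁ ((mK ⊗₁ id) ∘ λu⁻¹ (!₀ Y)))) ∎

  lam-of-coalg-of : ∀ {lam : Lam} →
    (∀ {X Y} {f : X ⇒ Y} → lam Y ∘ (id ⊗₁ !₁ f) ≈ !₁ (id ⊗₁ f) ∘ lam X) →
    (∀ {X Y} → !₁ (α A X Y) ∘ (lam (X ⊗₀ Y) ∘ (id ⊗₁ m X Y))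
                 ≈ m (A ⊗₀ X) Y ∘ ((lam X ⊗₁ id) ∘ α A (!₀ X) (!₀ Y))) →
    ∀ Y → lam-of (coalg-of lam) Y ≈ lam Y
  lam-of-coalg-of {lam} natural extra Y = begin
    lam-of (coalg-of lam) Y
      ≈⟨ lam-of-coalg-of-unfold {lam} ⟩
    !₁ (ρu A ⊗₁ id) ∘ ((m _ Y ∘ ((lam K ⊗₁ id) ∘ α _ _ _)) ∘ (id ⊗₁ ((mK ⊗₁ id) ∘ λu⁻¹ (!₀ Y))))
      ≈⟨ refl⟩∘⟨ (extra ⟩∘⟨refl) ⟨
    !₁ (ρu A ⊗₁ id) ∘ ((!₁ (α A K Y) ∘ (lam (K ⊗₀ Y) ∘ (id ⊗₁ m K Y)))
                        ∘ (id ⊗₁ ((mK ⊗₁ id) ∘ λu⁻¹ (!₀ Y))))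
      ≈⟨ refl⟩∘⟨ trans assoc (refl⟩∘⟨ trans assoc (refl⟩∘⟨ trans id⊗∘id⊗ (refl ⟩⊗⟨ m-unitˡ⁻¹))) ⟩
    !₁ (ρu A ⊗₁ id) ∘ (!₁ (α A K Y) ∘ (lam (K ⊗₀ Y) ∘ (id ⊗₁ !₁ (λu⁻¹ Y))))
      ≈⟨ refl⟩∘⟨ refl⟩∘⟨ natural ⟩
    !₁ (ρu A ⊗₁ id) ∘ (!₁ (α A K Y) ∘ (!₁ (id ⊗₁ λu⁻¹ Y) ∘ lam Y))
      ≈⟨ trans (refl⟩∘⟨ sym-assoc) (trans sym-assoc (trans (refl⟩∘⟨ !∘!) !∘! ⟩∘⟨refl)) ⟩
    !₁ ((ρu A ⊗₁ id) ∘ (α A K Y ∘ (id ⊗₁ λu⁻¹ Y))) ∘ lam Y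
      ≈⟨ !-resp-≈ (refl⟩∘⟨ triangle⁻¹) ⟩∘⟨refl ⟩
    !₁ ((ρu A ⊗₁ id) ∘ (ρu⁻¹ A ⊗₁ id)) ∘ lam Y
      ≈⟨ trans (trans (!-resp-≈ (⊗id-inverse ρ-isoʳ)) !-identity ⟩∘⟨refl) identityˡ ⟩
    lam Y ∎

module BimonoidCorrespondence {o ℓ e} (𝕏 : SymmetricMonoidalCategory o ℓ e) (Ω : SymMonComonad 𝕏)
                              (A : SymmetricMonoidalCategory.Obj 𝕏) (B : CocommBimonoid 𝕏 A) where
  open SymmetricMonoidalCategory 𝕏
  open SymMonComonad Ω
  open CocommBimonoid B
  open MonoidalReasoning 𝕏
  open ComonadReasoning 𝕏 Ω
  open CoalgebrasAndLaws 𝕏 Ω A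

  μ∇ : ∀ X → (A ⊗₀ (A ⊗₀ X)) ⇒ (A ⊗₀ X)
  μ∇ X = (∇ ⊗₁ id) ∘ α A A X

  ηu : ∀ X → X ⇒ (A ⊗₀ X)
  ηu X = (u ⊗₁ id) ∘ λu⁻¹ X

  nΔ : ∀ X Y → (A ⊗₀ (X ⊗₀ Y)) ⇒ ((A ⊗₀ X) ⊗₀ (A ⊗₀ Y))
  nΔ X Y = τ A A X Y ∘ (Δ ⊗₁ id)

  ne : (A ⊗₀ K) ⇒ K
  ne = ec ∘ ρu A

  IsDistLaw : Lam → Set (o ⊔ ℓ ⊔ e)
  IsDistLaw = IsSymMonMixedDistLaw 𝕏 Ω (A ⊗₀_) (id ⊗₁_) μ∇ ηu nΔ ne

  IsDistLaw-resp : ∀ {lam lam′ : Lam} → (∀ X → lam X ≈ lam′ X) → IsDistLaw lam → IsDistLaw lam′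
  IsDistLaw-resp eq law = record
    { natural = trans (sym (eq _) ⟩∘⟨refl) (trans natural (refl⟩∘⟨ eq _))
    ; law-μ   = trans (sym (eq _) ⟩∘⟨refl) (trans law-μ (refl⟩∘⟨ (eq _ ⟩∘⟨ (refl ⟩⊗⟨ eq _))))
    ; law-η   = trans (sym (eq _) ⟩∘⟨refl) law-η
    ; law-δ   = trans (refl⟩∘⟨ sym (eq _)) (trans law-δ (!-resp-≈ (eq _) ⟩∘⟨ (eq _ ⟩∘⟨refl)))
    ; law-ε   = trans (refl⟩∘⟨ sym (eq _)) law-ε
    ; law-m   = trans (refl⟩∘⟨ sym (eq _) ⟩∘⟨refl)
                  (trans law-m (refl⟩∘⟨ (eq _ ⟩⊗⟨ eq _) ⟩∘⟨refl))
    ; law-mK  = trans (refl⟩∘⟨ sym (eq _) ⟩∘⟨refl) law-mK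
    }
    where open IsSymMonMixedDistLaw law

  module LawSides (ω : A ⇒ !₀ A) where

    law-μ-lhs : ∀ {X} → lam-of ω X ∘ μ∇ (!₀ X) ≈ m A X ∘ (((ω ∘ ∇) ⊗₁ id) ∘ α A A (!₀ X))
    law-μ-lhs = trans assoc (refl⟩∘⟨ trans sym-assoc (⊗id∘⊗id ⟩∘⟨refl))

    law-μ-rhs : ∀ {X} → !₁ (μ∇ X) ∘ (lam-of ω (A ⊗₀ X) ∘ (id ⊗₁ lam-of ω X))
                  ≈ m A X ∘ (((!₁ ∇ ∘ (m A A ∘ (ω ⊗₁ ω))) ⊗₁ id) ∘ α A A (!₀ X))
    law-μ-rhs {X} = begin
      !₁ ((∇ ⊗₁ id) ∘ α A A X) ∘ ((m A (A ⊗₀ X) ∘ (ω ⊗₁ id)) ∘ (id ⊗₁ (m A X ∘ (ω ⊗₁ id))))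
        ≈⟨ !-homomorphism ⟩∘⟨ pullʳ (trans (sym serialize₁₂) (sym (trans ⊗∘⊗ (identityˡ ⟩⊗⟨ refl)))) ⟩
      (!₁ (∇ ⊗₁ id) ∘ !₁ (α A A X)) ∘ (m A (A ⊗₀ X) ∘ ((id ⊗₁ m A X) ∘ (ω ⊗₁ (ω ⊗₁ id))))
        ≈⟨ trans assoc (refl⟩∘⟨ trans (refl⟩∘⟨ sym-assoc) sym-assoc) ⟩
      !₁ (∇ ⊗₁ id) ∘ ((!₁ (α A A X) ∘ (m A (A ⊗₀ X) ∘ (id ⊗₁ m A X))) ∘ (ω ⊗₁ (ω ⊗₁ id)))
        ≈⟨ refl⟩∘⟨ m-assoc′ ⟩∘⟨refl ⟩
      !₁ (∇ ⊗₁ id) ∘ (((m (A ⊗₀ A) X ∘ (m A A ⊗₁ id)) ∘ α _ _ _) ∘ (ω ⊗₁ (ω ⊗₁ id)))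
        ≈⟨ refl⟩∘⟨ pullʳ α-natural ⟩
      !₁ (∇ ⊗₁ id) ∘ ((m (A ⊗₀ A) X ∘ (m A A ⊗₁ id)) ∘ (((ω ⊗₁ ω) ⊗₁ id) ∘ α _ _ _))
        ≈⟨ refl⟩∘⟨ trans assoc (refl⟩∘⟨ trans sym-assoc (⊗id∘⊗id ⟩∘⟨refl)) ⟩
      !₁ (∇ ⊗₁ id) ∘ (m (A ⊗₀ A) X ∘ (((m A A ∘ (ω ⊗₁ ω)) ⊗₁ id) ∘ α _ _ _))
        ≈⟨ trans sym-assoc (sym m-naturalˡ ⟩∘⟨refl) ⟩
      (m A X ∘ (!₁ ∇ ⊗₁ id)) ∘ (((m A A ∘ (ω ⊗₁ ω)) ⊗₁ id) ∘ α _ _ _)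
        ≈⟨ trans assoc (refl⟩∘⟨ trans sym-assoc (⊗id∘⊗id ⟩∘⟨refl)) ⟩
      m A X ∘ (((!₁ ∇ ∘ (m A A ∘ (ω ⊗₁ ω))) ⊗₁ id) ∘ α A A (!₀ X)) ∎

    law-η-lhs : ∀ {X} → lam-of ω X ∘ ηu (!₀ X) ≈ m A X ∘ (((ω ∘ u) ⊗₁ id) ∘ λu⁻¹ (!₀ X))
    law-η-lhs = trans assoc (refl⟩∘⟨ trans sym-assoc (⊗id∘⊗id ⟩∘⟨refl))

    law-η-rhs : ∀ {X} → !₁ (ηu X) ≈ m A X ∘ (((!₁ u ∘ mK) ⊗₁ id) ∘ λu⁻¹ (!₀ X))
    law-η-rhs {X} = sym (begin
      m A X ∘ (((!₁ u ∘ mK) ⊗₁ id) ∘ λu⁻¹ (!₀ X))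
        ≈⟨ refl⟩∘⟨ trans (sym ⊗id∘⊗id ⟩∘⟨refl) assoc ⟩
      m A X ∘ ((!₁ u ⊗₁ id) ∘ ((mK ⊗₁ id) ∘ λu⁻¹ (!₀ X)))
        ≈⟨ pullˡ m-naturalˡ ⟩
      (!₁ (u ⊗₁ id) ∘ m K X) ∘ ((mK ⊗₁ id) ∘ λu⁻¹ (!₀ X))
        ≈⟨ pullʳ m-unitˡ⁻¹ ⟩
      !₁ (u ⊗₁ id) ∘ !₁ (λu⁻¹ X)
        ≈⟨ !∘! ⟩
      !₁ (ηu X) ∎)

    law-δ-lhs : ∀ {X} → δ (A ⊗₀ X) ∘ lam-of ω X
                  ≈ !₁ (m A X) ∘ (m (!₀ A) (!₀ X) ∘ ((δ A ∘ ω) ⊗₁ δ X))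
    law-δ-lhs = trans sym-assoc (trans (δ-monoidal ⟩∘⟨refl)
                  (trans assoc (refl⟩∘⟨ trans assoc (refl⟩∘⟨ trans ⊗∘⊗ (refl ⟩⊗⟨ identityʳ)))))

    law-δ-rhs : ∀ {X} → !₁ (lam-of ω X) ∘ (lam-of ω (!₀ X) ∘ (id ⊗₁ δ X))
                  ≈ !₁ (m A X) ∘ (m (!₀ A) (!₀ X) ∘ ((!₁ ω ∘ ω) ⊗₁ δ X))
    law-δ-rhs {X} = begin
      !₁ (m A X ∘ (ω ⊗₁ id)) ∘ ((m A (!₀ X) ∘ (ω ⊗₁ id)) ∘ (id ⊗₁ δ X))
        ≈⟨ !-homomorphism ⟩∘⟨ pullʳ (sym serialize₁₂) ⟩
      (!₁ (m A X) ∘ !₁ (ω ⊗₁ id)) ∘ (m A (!₀ X) ∘ (ω ⊗₁ δ X))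
        ≈⟨ trans assoc (refl⟩∘⟨ trans sym-assoc (sym m-naturalˡ ⟩∘⟨refl)) ⟩
      !₁ (m A X) ∘ ((m (!₀ A) (!₀ X) ∘ (!₁ ω ⊗₁ id)) ∘ (ω ⊗₁ δ X))
        ≈⟨ refl⟩∘⟨ pullʳ (trans ⊗∘⊗ (refl ⟩⊗⟨ identityˡ)) ⟩
      !₁ (m A X) ∘ (m (!₀ A) (!₀ X) ∘ ((!₁ ω ∘ ω) ⊗₁ δ X)) ∎

    law-ε-lhs : ∀ {X} → ε (A ⊗₀ X) ∘ lam-of ω X ≈ (ε A ∘ ω) ⊗₁ ε X
    law-ε-lhs = trans sym-assoc (trans (ε-monoidal ⟩∘⟨refl) (trans ⊗∘⊗ (refl ⟩⊗⟨ identityʳ)))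

    law-m-lhs : ∀ {X Y} → !₁ (nΔ X Y) ∘ (lam-of ω (X ⊗₀ Y) ∘ (id ⊗₁ m X Y))
                  ≈ !₁ (τ A A X Y) ∘ (m (A ⊗₀ A) (X ⊗₀ Y) ∘ ((!₁ Δ ∘ ω) ⊗₁ m X Y))
    law-m-lhs = trans (!-homomorphism ⟩∘⟨ pullʳ (sym serialize₁₂))
                  (trans (trans assoc (refl⟩∘⟨ trans sym-assoc (sym m-naturalˡ ⟩∘⟨refl)))
                  (refl⟩∘⟨ pullʳ (trans ⊗∘⊗ (refl ⟩⊗⟨ identityˡ))))

    law-m-rhs : ∀ {X Y} → m (A ⊗₀ X) (A ⊗₀ Y) ∘ ((lam-of ω X ⊗₁ lam-of ω Y) ∘ nΔ (!₀ X) (!₀ Y))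
                  ≈ !₁ (τ A A X Y) ∘ (m (A ⊗₀ A) (X ⊗₀ Y) ∘ ((m A A ∘ ((ω ⊗₁ ω) ∘ Δ)) ⊗₁ m X Y))
    law-m-rhs {X} {Y} = begin
      m _ _ ∘ (((m A X ∘ (ω ⊗₁ id)) ⊗₁ (m A Y ∘ (ω ⊗₁ id))) ∘ (τ _ _ _ _ ∘ (Δ ⊗₁ id)))
        ≈⟨ refl⟩∘⟨ trans (⊗-homomorphism ⟩∘⟨refl) (trans assoc (refl⟩∘⟨ pullˡ (sym τ-natural))) ⟩
      m _ _ ∘ ((m A X ⊗₁ m A Y) ∘ ((τ _ _ _ _ ∘ ((ω ⊗₁ ω) ⊗₁ (id ⊗₁ id))) ∘ (Δ ⊗₁ id)))
        ≈⟨ trans sym-assoc (trans (refl⟩∘⟨ assoc) sym-assoc) ⟩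
      ((m _ _ ∘ (m A X ⊗₁ m A Y)) ∘ τ _ _ _ _) ∘ (((ω ⊗₁ ω) ⊗₁ (id ⊗₁ id)) ∘ (Δ ⊗₁ id))
        ≈⟨ sym m-τ ⟩∘⟨refl ⟩
      (!₁ (τ A A X Y) ∘ (m _ _ ∘ (m A A ⊗₁ m X Y))) ∘ (((ω ⊗₁ ω) ⊗₁ (id ⊗₁ id)) ∘ (Δ ⊗₁ id))
        ≈⟨ trans assoc (refl⟩∘⟨ trans assoc (refl⟩∘⟨ trans (refl⟩∘⟨ ⊗∘⊗) ⊗∘⊗)) ⟩
      !₁ (τ A A X Y) ∘ (m _ _ ∘ ((m A A ∘ ((ω ⊗₁ ω) ∘ Δ)) ⊗₁ (m X Y ∘ ((id ⊗₁ id) ∘ id))))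
        ≈⟨ refl⟩∘⟨ refl⟩∘⟨ (refl ⟩⊗⟨ trans (refl⟩∘⟨ trans identityʳ ⊗-identity) identityʳ) ⟩
      !₁ (τ A A X Y) ∘ (m (A ⊗₀ A) (X ⊗₀ Y) ∘ ((m A A ∘ ((ω ⊗₁ ω) ∘ Δ)) ⊗₁ m X Y)) ∎

    law-mK-lhs : !₁ ne ∘ (lam-of ω K ∘ (id ⊗₁ mK)) ≈ !₁ ec ∘ (ω ∘ ρu A)
    law-mK-lhs = trans (!-homomorphism ⟩∘⟨ trans (pullʳ slide-⊗) sym-assoc)
                   (trans (trans assoc (refl⟩∘⟨ sym-assoc))
                   (trans (refl⟩∘⟨ (m-unitʳ ⟩∘⟨refl)) (refl⟩∘⟨ ρ-natural)))

  law-from-coalgebra : (c : BimonoidInCoalgebras 𝕏 Ω A B) → IsDistLaw (lam-of (BimonoidInCoalgebras.ω c))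
  law-from-coalgebra c = record
    { natural = lam-of-natural
    ; law-μ   = trans law-μ-lhs (trans (refl⟩∘⟨ (∇-coalg ⟩⊗⟨ refl) ⟩∘⟨refl) (sym law-μ-rhs))
    ; law-η   = trans law-η-lhs (trans (refl⟩∘⟨ (u-coalg ⟩⊗⟨ refl) ⟩∘⟨refl) (sym law-η-rhs))
    ; law-δ   = trans law-δ-lhs (trans (refl⟩∘⟨ refl⟩∘⟨ (ω-coassoc ⟩⊗⟨ refl)) (sym law-δ-rhs))
    ; law-ε   = trans law-ε-lhs (ω-counit ⟩⊗⟨ refl)
    ; law-m   = trans law-m-lhs (trans (refl⟩∘⟨ refl⟩∘⟨ (sym Δ-coalg ⟩⊗⟨ refl)) (sym law-m-rhs))
    ; law-mK  = trans law-mK-lhs (trans sym-assoc (trans (sym ec-coalg ⟩∘⟨refl) assoc))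
    }
    where
    open BimonoidInCoalgebras c
    open LawSides ω

  coalgebra-from-law : (ω : A ⇒ !₀ A) → IsDistLaw (lam-of ω) → BimonoidInCoalgebras 𝕏 Ω A B
  coalgebra-from-law ω law = record
    { ω         = ω
    ; ω-coassoc = m-⊗δ-injective (trans (sym law-δ-lhs) (trans Law.law-δ law-δ-rhs))
    ; ω-counit  = ⊗ε-injective (trans (sym law-ε-lhs) Law.law-ε)
    ; ∇-coalg   = m-⊗id-injective (split-epi-cancel α-isoʳ
                    (trans assoc (trans (sym law-μ-lhs) (trans Law.law-μ (trans law-μ-rhs sym-assoc)))))
    ; u-coalg   = m-⊗id-injective (split-epi-cancel λ-isoˡ
                    (trans assoc (trans (sym law-η-lhs) (trans Law.law-η (trans law-η-rhs sym-assoc)))))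
    ; Δ-coalg   = sym (m-⊗mKK-injective (split-mono-cancel (!-inverse τ-involutive)
                    (trans (sym law-m-lhs) (trans Law.law-m law-m-rhs))))
    ; ec-coalg  = sym (split-epi-cancel ρ-isoʳ
                    (trans assoc (trans (sym law-mK-lhs) (trans Law.law-mK sym-assoc))))
    }
    where
    open LawSides ω
    module Law = IsSymMonMixedDistLaw law

  correspondence : Correspondence 𝕏 Ω A B
  correspondence = record
    { to      = to
    ; from    = from
    ; from∘to = λ c → coalg-of-lam-of (BimonoidInCoalgebras.ω c)
    ; to∘from = λ d → let open MixedDistLawFor d in
                      lam-of-coalg-of (IsSymMonMixedDistLaw.natural isDistLaw) extra
    }
    where
    to : BimonoidInCoalgebras 𝕏 Ω A B → MixedDistLawFor 𝕏 Ω A B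
    to c = record { lam = lam-of (BimonoidInCoalgebras.ω c)
                  ; isDistLaw = law-from-coalgebra c
                  ; extra = lam-of-extra }
    from : MixedDistLawFor 𝕏 Ω A B → BimonoidInCoalgebras 𝕏 Ω A B
    from d = coalgebra-from-law (coalg-of lam)
               (IsDistLaw-resp (λ X → sym (lam-of-coalg-of natural extra X)) isDistLaw)
      where
      open MixedDistLawFor d using (lam; isDistLaw; extra)
      open IsSymMonMixedDistLaw isDistLaw using (natural)

proposition5p5 : ∀ {o ℓ e} (𝕏 : SymmetricMonoidalCategory o ℓ e) (Ω : SymMonComonad 𝕏)
                   (A : SymmetricMonoidalCategory.Obj 𝕏) (B : CocommBimonoid 𝕏 A) →
                   Correspondence 𝕏 Ω A B
proposition5p5 𝕏 Ω A B = BimonoidCorrespondence.correspondence 𝕏 Ω A B
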